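{- For every positive integer $k$, the following identity of formal power series in $x$ holds: $$\frac{\sum_{j=0}^{k-1}\left\langle \begin{matrix} k-1\\ j\end{matrix}\right\rangle_2 x^j}{(1-x)^{2k+1}}=\sum_{n\ge0}\left\langle \begin{matrix} n+k\\ k\end{matrix}\right\rangle_2 x^n .$$
   Context: For integers $m\ge0$, $\langle m\rangle_2=\binom{m+1}{2}$, and for $0\le k\le n$, $\left\langle \begin{matrix} n\\ k\end{matrix}\right\rangle_2=\prod_{j=0}^{k-1}\frac{\langle n-j\rangle_2}{\langle k-j\rangle_2}$ (equal to $\frac{1}{k+1}\binom{n}{k}\binom{n+1}{k}$, the Narayana numbers). -}

module Defs where

open import Data.Nat as ℕ using (ℕ; zero; suc; _∸_; _<?_)
open import Data.Nat.Combinatorics using (_C_)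
open import Data.Integer using (+_)
open import Data.Rational using (ℚ; 0ℚ; 1ℚ; _/_; _+_; _*_; -_)
open import Relation.Nullary using (yes; no)

⟨_⟩₂ : ℕ → ℕ
⟨ m ⟩₂ = suc m C 2

-- a / d as a rational; the value for d = 0 is a junk value that is
-- never used below (all denominators ⟨k-j⟩₂ with j < k are nonzero).
frac : ℕ → ℕ → ℚ
frac a zero    = 0ℚ
frac a (suc d) = (+ a) / suc d

prodBelow : ℕ → (ℕ → ℚ) → ℚ
prodBelow zero    f = 1ℚ
prodBelow (suc k) f = prodBelow k f * f k

sumBelow : ℕ → (ℕ → ℚ) → ℚ
sumBelow zero    f = 0ℚ
sumBelow (suc k) f = sumBelow k f + f k

gbin₂ : ℕ → ℕ → ℚ
gbin₂ n k = prodBelow k (λ j → frac ⟨ n ∸ j ⟩₂ ⟨ k ∸ j ⟩₂)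

FPS : Set
FPS = ℕ → ℚ

_⊛_ : FPS → FPS → FPS
(f ⊛ g) n = sumBelow (suc n) (λ i → f i * g (n ∸ i))

oneS : FPS
oneS zero = 1ℚ
oneS (suc n) = 0ℚ

_^S_ : FPS → ℕ → FPS
f ^S zero  = oneS
f ^S suc e = f ⊛ (f ^S e)

oneMinusX : FPS
oneMinusX zero = 1ℚ
oneMinusX (suc zero) = - 1ℚ
oneMinusX (suc (suc n)) = 0ℚ

numer : ℕ → FPS
numer k n with n <? k
... | yes _ = gbin₂ (k ∸ 1) n
... | no  _ = 0ℚ

rhsSeries : ℕ → FPS
rhsSeries k n = gbin₂ (n ℕ.+ k) k

module Submission where

-- Write Aₖ for the series on the right and Pₖ for the numerator. Multiplying by 1 − x is the
-- backward difference ∇, so the claim is ∇^(2k+1) Aₖ = Pₖ for k ≥ 1. Both families satisfy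
--   (t + 3) X_{t+2} = (2t + 3) (1 + x) X_{t+1} − t (1 − x)² X_t :
-- for Pₖ this is the three-term recurrence of the Narayana polynomials, and for ∇^(2k+1) Aₖ it
-- follows by applying ∇^(2t+3) to (t + 3) (1 − x)² A_{t+2} = (2t + 3) (1 + x) A_{t+1} − t A_t.
-- The last coefficient vanishes at t = 0, so X₁ determines all Xₖ with k ≥ 1, and both
-- sequences start with X₁ = 1. Each recurrence is checked coefficientwise after clearing
-- denominators: with fall₂ N k = ∏_{j<k} (N − j)(N − j + 1) one has ⟨N; k⟩₂ = fall₂ N k / fall₂ k k,
-- every term becomes a polynomial multiple of one such product, and what remains is a
-- polynomial identity.

open import Defs
open import Data.Nat as ℕ using (ℕ; zero; suc; _∸_; _<_; _≤_; s≤s; z≤n)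
open import Data.Sum using (inj₁; inj₂)
open import Data.Product using (_×_; _,_; proj₁)
open import Relation.Nullary using (yes; no)
open import Data.Nat.Properties as ℕ using ()
open import Data.Nat.Combinatorics using (nC1≡n; nCk+nC[k+1]≡[n+1]C[k+1])
open import Data.Integer as ℤ using (1ℤ)
open import Data.Rational using (ℚ; 0ℚ; 1ℚ; _/_; _+_; _*_; _-_; toℚᵘ; 1/_; ≢-nonZero)
open import Data.Rational.Properties as ℚ using (+-*-commutativeRing; _≟_)
import Data.Rational.Unnormalised as ℚᵘ
import Data.Rational.Unnormalised.Properties as ℚᵘ
open import Algebra.Bundles using (CommutativeRing; CommutativeMonoid)
open import Algebra.Properties.CommutativeSemigroup
  (CommutativeMonoid.commutativeSemigroup ℚ.*-1-commutativeMonoid) using (interchange; x∙yz≈y∙xz)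
open import Algebra.Properties.Semiring.Mult (CommutativeRing.semiring +-*-commutativeRing)
  using (×-homo-+; ×1-homo-*) renaming (_×_ to _×ℚ_)
open import Relation.Nullary.Decidable.Core using (dec⇒maybe)
import Tactic.RingSolver.Core.AlmostCommutativeRing as ACR
open import Tactic.RingSolver using (solve-∀)
open import Data.Nat.Tactic.RingSolver using () renaming (solve-∀ to ℕ-solve-∀)
open import Data.Integer.Tactic.RingSolver using () renaming (solve-∀ to ℤ-solve-∀)
open import Relation.Binary.PropositionalEquality
open ≡-Reasoning
open import Function using (_∘_)

ℚ-ring : ACR.AlmostCommutativeRing _ _
ℚ-ring = ACR.fromCommutativeRing +-*-commutativeRing (λ q → dec⇒maybe (0ℚ ≟ q))

2ℚ 3ℚ : ℚ
2ℚ = 1ℚ + 1ℚ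
3ℚ = 2ℚ + 1ℚ

ι : ℕ → ℚ
ι n = n ×ℚ 1ℚ

ι-+ : ∀ m n → ι (m ℕ.+ n) ≡ ι m + ι n
ι-+ m n = ×-homo-+ 1ℚ m n

ι-* : ∀ m n → ι (m ℕ.* n) ≡ ι m * ι n
ι-* = ×1-homo-*

toℚᵘ-ι : ∀ n → toℚᵘ (ι n) ℚᵘ.≃ ℚᵘ.mkℚᵘ (ℤ.+ n) 0
toℚᵘ-ι zero = ℚᵘ.*≡* refl
toℚᵘ-ι (suc n) = ℚᵘ.≃-trans (ℚ.toℚᵘ-homo-+ 1ℚ (ι n))
  (ℚᵘ.≃-trans (ℚᵘ.+-congʳ (toℚᵘ 1ℚ) (toℚᵘ-ι n)) (ℚᵘ.*≡* (ℤ-lemma (ℤ.+ n))))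
  where
  ℤ-lemma : ∀ x → (1ℤ ℤ.* 1ℤ ℤ.+ x ℤ.* 1ℤ) ℤ.* 1ℤ ≡ (1ℤ ℤ.+ x) ℤ.* (1ℤ ℤ.* 1ℤ)
  ℤ-lemma = ℤ-solve-∀

ι-suc≢0 : ∀ n → ι (suc n) ≢ 0ℚ
ι-suc≢0 n eq with ℚᵘ.≃-trans (ℚᵘ.≃-sym (toℚᵘ-ι (suc n))) (ℚ.toℚᵘ-cong eq)
... | ℚᵘ.*≡* ()

/-*-ι : ∀ a e → ((ℤ.+ a) / suc e) * ι (suc e) ≡ ι a
/-*-ι a e = ℚ.toℚᵘ-injective
  (ℚᵘ.≃-trans (ℚ.toℚᵘ-homo-* (ℤ.+ a / suc e) (ι (suc e)))
  (ℚᵘ.≃-trans (ℚᵘ.*-cong (ℚ.toℚᵘ-fromℚᵘ (ℚᵘ.mkℚᵘ (ℤ.+ a) e)) (toℚᵘ-ι (suc e)))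
  (ℚᵘ.≃-trans (ℚᵘ.*≡* (ℤ-lemma (ℤ.+ a) (ℤ.+ suc e))) (ℚᵘ.≃-sym (toℚᵘ-ι a)))))
  where
  ℤ-lemma : ∀ x y → (x ℤ.* y) ℤ.* 1ℤ ≡ x ℤ.* (y ℤ.* 1ℤ)
  ℤ-lemma = ℤ-solve-∀

*-cancelˡ-≢0 : ∀ p {q r} → p ≢ 0ℚ → p * q ≡ p * r → q ≡ r
*-cancelˡ-≢0 p {q} {r} p≢0 pq≡pr = begin
  q               ≡⟨ cancel-intro q ⟩
  p⁻¹ * p * q     ≡⟨ ℚ.*-assoc p⁻¹ p q ⟩
  p⁻¹ * (p * q)   ≡⟨ cong (p⁻¹ *_) pq≡pr ⟩
  p⁻¹ * (p * r)   ≡⟨ ℚ.*-assoc p⁻¹ p r ⟨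
  p⁻¹ * p * r     ≡⟨ cancel-intro r ⟨
  r               ∎
  where
  instance _ = ≢-nonZero p≢0
  p⁻¹ = 1/ p
  cancel-intro : ∀ x → x ≡ p⁻¹ * p * x
  cancel-intro x = trans (sym (ℚ.*-identityˡ x)) (cong (_* x) (sym (ℚ.*-inverseˡ p)))

*-≢0 : ∀ {p q} → p ≢ 0ℚ → q ≢ 0ℚ → p * q ≢ 0ℚ
*-≢0 {p} {q} p≢0 q≢0 pq≡0 = q≢0 (*-cancelˡ-≢0 p p≢0 (trans pq≡0 (sym (ℚ.*-zeroʳ p))))

cong₃ : ∀ (f : ℚ → ℚ → ℚ → ℚ) {x x′ y y′ z z′} → x ≡ x′ → y ≡ y′ → z ≡ z′ → f x y z ≡ f x′ y′ z′
cong₃ f refl refl refl = refl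

-- shift f = x f,  ∇ f = (1 − x) f,  ∇⁺ f = (1 + x) f.
infixl 6 _+ₛ_ _-ₛ_
infixr 7 _·ₛ_

_+ₛ_ _-ₛ_ : FPS → FPS → FPS
(f +ₛ g) n = f n + g n
(f -ₛ g) n = f n - g n

_·ₛ_ : ℚ → FPS → FPS
(a ·ₛ f) n = a * f n

shift : FPS → FPS
shift f zero    = 0ℚ
shift f (suc n) = f n

∇ ∇⁺ : FPS → FPS
∇ f  = f -ₛ shift f
∇⁺ f = f +ₛ shift f

∇^ : ℕ → FPS → FPS
∇^ zero    f = f
∇^ (suc e) f = ∇ (∇^ e f)

shift-cong : ∀ {f g} → f ≗ g → shift f ≗ shift g
shift-cong f≗g zero    = refl
shift-cong f≗g (suc n) = f≗g n

∇-cong : ∀ {f g} → f ≗ g → ∇ f ≗ ∇ g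
∇-cong f≗g n = cong₂ _-_ (f≗g n) (shift-cong f≗g n)

∇⁺-cong : ∀ {f g} → f ≗ g → ∇⁺ f ≗ ∇⁺ g
∇⁺-cong f≗g n = cong₂ _+_ (f≗g n) (shift-cong f≗g n)

∇^-cong : ∀ e {f g} → f ≗ g → ∇^ e f ≗ ∇^ e g
∇^-cong zero    f≗g = f≗g
∇^-cong (suc e) f≗g = ∇-cong (∇^-cong e f≗g)

shift-·ₛ : ∀ a f → shift (a ·ₛ f) ≗ a ·ₛ shift f
shift-·ₛ a f zero    = sym (ℚ.*-zeroʳ a)
shift-·ₛ a f (suc n) = refl

shift--ₛ : ∀ f g → shift (f -ₛ g) ≗ shift f -ₛ shift g
shift--ₛ f g zero    = refl
shift--ₛ f g (suc n) = refl

shift-+ₛ : ∀ f g → shift (f +ₛ g) ≗ shift f +ₛ shift g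
shift-+ₛ f g zero    = refl
shift-+ₛ f g (suc n) = refl

shift-∇ : ∀ f → shift (∇ f) ≗ ∇ (shift f)
shift-∇ f = shift--ₛ f (shift f)

∇-·ₛ : ∀ a f → ∇ (a ·ₛ f) ≗ a ·ₛ ∇ f
∇-·ₛ a f n = trans (cong ((a * f n) -_) (shift-·ₛ a f n)) (distrib a (f n) (shift f n))
  where distrib : ∀ a x y → a * x - a * y ≡ a * (x - y)
        distrib = solve-∀ ℚ-ring

∇--ₛ : ∀ f g → ∇ (f -ₛ g) ≗ ∇ f -ₛ ∇ g
∇--ₛ f g n = trans (cong ((f n - g n) -_) (shift--ₛ f g n)) (interchange-- (f n) (g n) (shift f n) (shift g n))
  where interchange-- : ∀ a b c d → (a - b) - (c - d) ≡ (a - c) - (b - d)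
        interchange-- = solve-∀ ℚ-ring

∇-∇⁺ : ∀ f → ∇ (∇⁺ f) ≗ ∇⁺ (∇ f)
∇-∇⁺ f n = begin
  (f n + shift f n) - shift (f +ₛ shift f) n         ≡⟨ cong ((f n + shift f n) -_) (shift-+ₛ f (shift f) n) ⟩
  (f n + shift f n) - (shift f n + shift (shift f) n) ≡⟨ regroup (f n) (shift f n) (shift (shift f) n) ⟩
  (f n - shift f n) + (shift f n - shift (shift f) n) ≡⟨ cong ((f n - shift f n) +_) (shift-∇ f n) ⟨
  (f n - shift f n) + shift (∇ f) n                   ∎
  where regroup : ∀ a b c → (a + b) - (b + c) ≡ (a - b) + (b - c)
        regroup = solve-∀ ℚ-ring

∇^-commute : (L : FPS → FPS) → (∀ {f g} → f ≗ g → L f ≗ L g) → (∀ f → ∇ (L f) ≗ L (∇ f)) →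
             ∀ e f → ∇^ e (L f) ≗ L (∇^ e f)
∇^-commute L L-cong ∇L≗L∇ zero    f n = refl
∇^-commute L L-cong ∇L≗L∇ (suc e) f n =
  trans (∇-cong (∇^-commute L L-cong ∇L≗L∇ e f) n) (∇L≗L∇ (∇^ e f) n)

∇^--ₛ : ∀ e f g → ∇^ e (f -ₛ g) ≗ ∇^ e f -ₛ ∇^ e g
∇^--ₛ zero    f g n = refl
∇^--ₛ (suc e) f g n = trans (∇-cong (∇^--ₛ e f g) n) (∇--ₛ (∇^ e f) (∇^ e g) n)

∇^-·ₛ : ∀ e a f → ∇^ e (a ·ₛ f) ≗ a ·ₛ ∇^ e f
∇^-·ₛ e a = ∇^-commute (a ·ₛ_) (λ f≗g n → cong (a *_) (f≗g n)) (∇-·ₛ a) e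

∇^-∇⁺ : ∀ e f → ∇^ e (∇⁺ f) ≗ ∇⁺ (∇^ e f)
∇^-∇⁺ = ∇^-commute ∇⁺ ∇⁺-cong ∇-∇⁺

∇^-∇ : ∀ e f → ∇^ e (∇ f) ≗ ∇ (∇^ e f)
∇^-∇ = ∇^-commute ∇ ∇-cong (λ f n → refl)

sumBelow-peel : ∀ m f → sumBelow (suc m) f ≡ f 0 + sumBelow m (λ i → f (suc i))
sumBelow-peel zero    f = trans (ℚ.+-identityˡ (f 0)) (sym (ℚ.+-identityʳ (f 0)))
sumBelow-peel (suc m) f = trans (cong (_+ f (suc m)) (sumBelow-peel m f)) (ℚ.+-assoc (f 0) _ _)

sumBelow-cong : ∀ m {f g} → f ≗ g → sumBelow m f ≡ sumBelow m g
sumBelow-cong zero    f≗g = refl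
sumBelow-cong (suc m) f≗g = cong₂ _+_ (sumBelow-cong m f≗g) (f≗g m)

sumBelow-- : ∀ m f g → sumBelow m (λ i → f i - g i) ≡ sumBelow m f - sumBelow m g
sumBelow-- zero    f g = refl
sumBelow-- (suc m) f g = trans (cong (_+ (f m - g m)) (sumBelow-- m f g))
  (regroup (sumBelow m f) (sumBelow m g) (f m) (g m))
  where regroup : ∀ a b c d → (a - b) + (c - d) ≡ (a + c) - (b + d)
        regroup = solve-∀ ℚ-ring

sumBelow-0 : ∀ m f → (∀ i → f i ≡ 0ℚ) → sumBelow m f ≡ 0ℚ
sumBelow-0 zero    f f≡0 = refl
sumBelow-0 (suc m) f f≡0 = cong₂ _+_ (sumBelow-0 m f f≡0) (f≡0 m)

⊛-congˡ : ∀ {f f′} g → f ≗ f′ → f ⊛ g ≗ f′ ⊛ g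
⊛-congˡ g f≗f′ n = sumBelow-cong (suc n) (λ i → cong (_* g (n ∸ i)) (f≗f′ i))

oneS-⊛ : ∀ g → oneS ⊛ g ≗ g
oneS-⊛ g n = begin
  sumBelow (suc n) (λ i → oneS i * g (n ∸ i))
    ≡⟨ sumBelow-peel n _ ⟩
  1ℚ * g n + sumBelow n (λ i → 0ℚ * g (n ∸ suc i))
    ≡⟨ cong (1ℚ * g n +_) (sumBelow-0 n _ (λ i → ℚ.*-zeroˡ (g (n ∸ suc i)))) ⟩
  1ℚ * g n + 0ℚ
    ≡⟨ trans (ℚ.+-identityʳ _) (ℚ.*-identityˡ (g n)) ⟩
  g n ∎

shift-⊛ : ∀ f g → shift f ⊛ g ≗ shift (f ⊛ g)
shift-⊛ f g zero    = trans (ℚ.+-identityˡ _) (ℚ.*-zeroˡ (g 0))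
shift-⊛ f g (suc n) = begin
  sumBelow (suc (suc n)) (λ i → shift f i * g (suc n ∸ i))  ≡⟨ sumBelow-peel (suc n) _ ⟩
  0ℚ * g (suc n) + (f ⊛ g) n                                ≡⟨ cong (_+ (f ⊛ g) n) (ℚ.*-zeroˡ (g (suc n))) ⟩
  0ℚ + (f ⊛ g) n                                            ≡⟨ ℚ.+-identityˡ _ ⟩
  (f ⊛ g) n                                                 ∎

⊛-distribʳ--ₛ : ∀ f h g → (f -ₛ h) ⊛ g ≗ f ⊛ g -ₛ h ⊛ g
⊛-distribʳ--ₛ f h g n =
  trans (sumBelow-cong (suc n) (λ i → distrib (f i) (h i) (g (n ∸ i)))) (sumBelow-- (suc n) _ _)
  where distrib : ∀ a b c → (a - b) * c ≡ a * c - b * c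
        distrib = solve-∀ ℚ-ring

∇-⊛ : ∀ f g → ∇ f ⊛ g ≗ ∇ (f ⊛ g)
∇-⊛ f g n = trans (⊛-distribʳ--ₛ f (shift f) g n) (cong ((f ⊛ g) n -_) (shift-⊛ f g n))

oneMinusX-⊛ : ∀ f → oneMinusX ⊛ f ≗ ∇ f
oneMinusX-⊛ f n = begin
  (oneMinusX ⊛ f) n     ≡⟨ ⊛-congˡ f oneMinusX≗∇oneS n ⟩
  (∇ oneS ⊛ f) n        ≡⟨ ∇-⊛ oneS f n ⟩
  ∇ (oneS ⊛ f) n        ≡⟨ ∇-cong (oneS-⊛ f) n ⟩
  ∇ f n                 ∎
  where
  oneMinusX≗∇oneS : oneMinusX ≗ ∇ oneS
  oneMinusX≗∇oneS zero          = refl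
  oneMinusX≗∇oneS (suc zero)    = refl
  oneMinusX≗∇oneS (suc (suc n)) = refl

^S-⊛ : ∀ e g → (oneMinusX ^S e) ⊛ g ≗ ∇^ e g
^S-⊛ zero    g = oneS-⊛ g
^S-⊛ (suc e) g n = begin
  ((oneMinusX ⊛ P) ⊛ g) n    ≡⟨ ⊛-congˡ g (oneMinusX-⊛ P) n ⟩
  (∇ P ⊛ g) n                ≡⟨ ∇-⊛ P g n ⟩
  ∇ (P ⊛ g) n                ≡⟨ ∇-cong (^S-⊛ e g) n ⟩
  ∇ (∇^ e g) n               ∎
  where P = oneMinusX ^S e

Recurrence : (ℕ → FPS) → Set
Recurrence X = ∀ t → let τ = ι t in
  (3ℚ + τ) ·ₛ X (2 ℕ.+ t) ≗ (3ℚ + 2ℚ * τ) ·ₛ ∇⁺ (X (1 ℕ.+ t)) -ₛ τ ·ₛ ∇ (∇ (X t))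

3+ι≢0 : ∀ t → 3ℚ + ι t ≢ 0ℚ
3+ι≢0 t = ι-suc≢0 (2 ℕ.+ t) ∘ trans (rearrange (ι t))
  where rearrange : ∀ x → 1ℚ + (1ℚ + (1ℚ + x)) ≡ 3ℚ + x
        rearrange = solve-∀ ℚ-ring

recurrence-step : ∀ {X Y} → Recurrence X → Recurrence Y → ∀ t →
  X (1 ℕ.+ t) ≗ Y (1 ℕ.+ t) → ι t ·ₛ ∇ (∇ (X t)) ≗ ι t ·ₛ ∇ (∇ (Y t)) →
  X (2 ℕ.+ t) ≗ Y (2 ℕ.+ t)
recurrence-step {X} {Y} recX recY t X₁≗Y₁ ∇²X₀≗∇²Y₀ n = *-cancelˡ-≢0 (3ℚ + ι t) (3+ι≢0 t) (begin
  (3ℚ + ι t) * X (2 ℕ.+ t) n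
    ≡⟨ recX t n ⟩
  (3ℚ + 2ℚ * ι t) * ∇⁺ (X (1 ℕ.+ t)) n - ι t * ∇ (∇ (X t)) n
    ≡⟨ cong₂ (λ u v → (3ℚ + 2ℚ * ι t) * u - v) (∇⁺-cong X₁≗Y₁ n) (∇²X₀≗∇²Y₀ n) ⟩
  (3ℚ + 2ℚ * ι t) * ∇⁺ (Y (1 ℕ.+ t)) n - ι t * ∇ (∇ (Y t)) n
    ≡⟨ recY t n ⟨
  (3ℚ + ι t) * Y (2 ℕ.+ t) n ∎)

recurrence-unique : ∀ {X Y} → Recurrence X → Recurrence Y → X 1 ≗ Y 1 → ∀ k → X (suc k) ≗ Y (suc k)
recurrence-unique {X} {Y} recX recY X₁≗Y₁ k = proj₁ (consecutive k)
  where
  consecutive : ∀ k → X (1 ℕ.+ k) ≗ Y (1 ℕ.+ k) × X (2 ℕ.+ k) ≗ Y (2 ℕ.+ k)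
  consecutive zero    = X₁≗Y₁ , recurrence-step {X} {Y} recX recY 0 X₁≗Y₁
    (λ n → trans (ℚ.*-zeroˡ (∇ (∇ (X 0)) n)) (sym (ℚ.*-zeroˡ (∇ (∇ (Y 0)) n))))
  consecutive (suc k) = let (Xₖ≗Yₖ , Xₖ₊₁≗Yₖ₊₁) = consecutive k in
    Xₖ₊₁≗Yₖ₊₁ , recurrence-step {X} {Y} recX recY (suc k) Xₖ₊₁≗Yₖ₊₁
                  (λ n → cong (ι (suc k) *_) (∇-cong (∇-cong Xₖ≗Yₖ) n))

pronic : ℚ → ℚ
pronic q = q * (1ℚ + q)

pronic-ι-suc≢0 : ∀ n → pronic (ι (suc n)) ≢ 0ℚ
pronic-ι-suc≢0 n = *-≢0 (ι-suc≢0 n) (ι-suc≢0 (suc n))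

⟨suc⟩₂ : ∀ m → ⟨ suc m ⟩₂ ≡ suc m ℕ.+ ⟨ m ⟩₂
⟨suc⟩₂ m = trans (sym (nCk+nC[k+1]≡[n+1]C[k+1] (suc m) 1)) (cong (ℕ._+ ⟨ m ⟩₂) (nC1≡n (suc m)))

pronic-ι : ∀ m → pronic (ι m) ≡ ι ⟨ m ⟩₂ * 2ℚ
pronic-ι zero = refl
pronic-ι (suc m) = begin
  pronic (1ℚ + ι m)                  ≡⟨ split (ι m) ⟩
  (1ℚ + ι m) * 2ℚ + pronic (ι m)     ≡⟨ cong (((1ℚ + ι m) * 2ℚ) +_) (pronic-ι m) ⟩
  (1ℚ + ι m) * 2ℚ + ι ⟨ m ⟩₂ * 2ℚ   ≡⟨ ℚ.*-distribʳ-+ 2ℚ (ι (suc m)) (ι ⟨ m ⟩₂) ⟨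
  (ι (suc m) + ι ⟨ m ⟩₂) * 2ℚ        ≡⟨ cong (_* 2ℚ) (trans (cong ι (⟨suc⟩₂ m)) (ι-+ (suc m) ⟨ m ⟩₂)) ⟨
  ι ⟨ suc m ⟩₂ * 2ℚ                  ∎
  where
  split : ∀ x → (1ℚ + x) * (1ℚ + (1ℚ + x)) ≡ (1ℚ + x) * 2ℚ + x * (1ℚ + x)
  split = solve-∀ ℚ-ring

prodBelow-peel : ∀ k f → prodBelow (suc k) f ≡ f 0 * prodBelow k (λ j → f (suc j))
prodBelow-peel zero    f = trans (ℚ.*-identityˡ (f 0)) (sym (ℚ.*-identityʳ (f 0)))
prodBelow-peel (suc k) f = trans (cong (_* f (suc k)) (prodBelow-peel k f)) (ℚ.*-assoc (f 0) _ _)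

prodBelow-* : ∀ k f g → prodBelow k f * prodBelow k g ≡ prodBelow k (λ j → f j * g j)
prodBelow-* zero    f g = ℚ.*-identityˡ 1ℚ
prodBelow-* (suc k) f g = trans (interchange (prodBelow k f) (f k) (prodBelow k g) (g k)) (cong (_* (f k * g k)) (prodBelow-* k f g))

prodBelow-cong : ∀ k {f g} → (∀ j → j < k → f j ≡ g j) → prodBelow k f ≡ prodBelow k g
prodBelow-cong zero    f≡g = refl
prodBelow-cong (suc k) f≡g =
  cong₂ _*_ (prodBelow-cong k (λ j j<k → f≡g j (ℕ.m<n⇒m<1+n j<k))) (f≡g k ℕ.≤-refl)

prodBelow-zero : ∀ {j k} f → j < k → f j ≡ 0ℚ → prodBelow k f ≡ 0ℚ
prodBelow-zero {k = suc k} f j<1+k fj≡0 with ℕ.m≤n⇒m<n∨m≡n (ℕ.s≤s⁻¹ j<1+k)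
... | inj₁ j<k  = trans (cong (_* f k) (prodBelow-zero f j<k fj≡0)) (ℚ.*-zeroˡ (f k))
... | inj₂ refl = trans (cong (prodBelow k f *_) fj≡0) (ℚ.*-zeroʳ (prodBelow k f))

fall₂ : ℕ → ℕ → ℚ
fall₂ N k = prodBelow k (λ j → pronic (ι (N ∸ j)))

fall₂-suc : ∀ N k → fall₂ (suc N) (suc k) ≡ pronic (ι (suc N)) * fall₂ N k
fall₂-suc N k = prodBelow-peel k (λ j → pronic (ι (suc N ∸ j)))

fall₂-vanishes : ∀ {N k} → N < k → fall₂ N k ≡ 0ℚ
fall₂-vanishes {N} N<k = prodBelow-zero _ N<k (cong (pronic ∘ ι) (ℕ.n∸n≡0 N))

fall₂-diag≢0 : ∀ k → fall₂ k k ≢ 0ℚ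
fall₂-diag≢0 zero    = λ ()
fall₂-diag≢0 (suc k) rewrite fall₂-suc k k = *-≢0 (pronic-ι-suc≢0 k) (fall₂-diag≢0 k)

fall₂-diag-suc-* : ∀ k x → fall₂ (suc k) (suc k) * x ≡ pronic (ι (suc k)) * (fall₂ k k * x)
fall₂-diag-suc-* k x = trans (cong (_* x) (fall₂-suc k k)) (ℚ.*-assoc (pronic (ι (suc k))) (fall₂ k k) x)

-- Also true for N < k, where both sides vanish.
fall₂-step : ∀ N k → fall₂ N (suc k) ≡ fall₂ N k * pronic (ι N - ι k)
fall₂-step N k with ℕ.≤-<-connex k N
... | inj₁ k≤N = cong (λ x → fall₂ N k * pronic x) (begin
  ι (N ∸ k)                  ≡⟨ cancel (ι k) (ι (N ∸ k)) ⟩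
  (ι k + ι (N ∸ k)) - ι k    ≡⟨ cong (_- ι k) (trans (sym (ι-+ k (N ∸ k))) (cong ι (ℕ.m+[n∸m]≡n k≤N))) ⟩
  ι N - ι k                  ∎)
  where
  cancel : ∀ a b → b ≡ (a + b) - a
  cancel = solve-∀ ℚ-ring
... | inj₂ N<k = begin
  fall₂ N (suc k)                   ≡⟨ fall₂-vanishes (ℕ.m<n⇒m<1+n N<k) ⟩
  0ℚ                                ≡⟨ ℚ.*-zeroˡ y ⟨
  0ℚ * y                            ≡⟨ cong (_* y) (fall₂-vanishes N<k) ⟨
  fall₂ N k * y                     ∎
  where y = pronic (ι N - ι k)

frac-*-ι : ∀ a {d} → 0 < d → frac a d * ι d ≡ ι a
frac-*-ι a {suc e} _ = /-*-ι a e

frac-pronic : ∀ a {d} → 0 < d → frac ⟨ a ⟩₂ ⟨ d ⟩₂ * pronic (ι d) ≡ pronic (ι a)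
frac-pronic a {suc d} _ = begin
  q * pronic (ι (suc d))          ≡⟨ cong (q *_) (pronic-ι (suc d)) ⟩
  q * (ι ⟨ suc d ⟩₂ * 2ℚ)         ≡⟨ ℚ.*-assoc q _ 2ℚ ⟨
  q * ι ⟨ suc d ⟩₂ * 2ℚ           ≡⟨ cong (_* 2ℚ) (frac-*-ι ⟨ a ⟩₂ positive) ⟩
  ι ⟨ a ⟩₂ * 2ℚ                   ≡⟨ pronic-ι a ⟨
  pronic (ι a)                    ∎
  where
  q = frac ⟨ a ⟩₂ ⟨ suc d ⟩₂
  positive : 0 < ⟨ suc d ⟩₂
  positive = subst (0 <_) (sym (⟨suc⟩₂ d)) (s≤s z≤n)

gbin₂-normal : ∀ N k → gbin₂ N k * fall₂ k k ≡ fall₂ N k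
gbin₂-normal N k = trans (prodBelow-* k _ _)
  (prodBelow-cong k (λ j j<k → frac-pronic (N ∸ j) (ℕ.m<n⇒0<n∸m j<k)))

rhs-scaled : ∀ k n → fall₂ k k * rhsSeries k n ≡ fall₂ (n ℕ.+ k) k
rhs-scaled k n = trans (ℚ.*-comm (fall₂ k k) _) (gbin₂-normal (n ℕ.+ k) k)

fall₂-up : ∀ n k → fall₂ (n ℕ.+ suc k) (suc k) ≡ pronic (1ℚ + (ι n + ι k)) * fall₂ (n ℕ.+ k) k
fall₂-up n k rewrite ℕ.+-suc n k =
  trans (fall₂-suc (n ℕ.+ k) k) (cong (λ x → pronic (1ℚ + x) * fall₂ (n ℕ.+ k) k) (ι-+ n k))

fall₂-diag : ∀ n k → fall₂ (n ℕ.+ suc k) (suc k) ≡ fall₂ (suc n ℕ.+ k) k * pronic (ι (suc n))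
fall₂-diag n k rewrite ℕ.+-suc n k = cong (λ m → fall₂ (suc n ℕ.+ k) k * pronic (ι m)) (ℕ.m+n∸n≡m (suc n) k)

rhs-shift-scaled : ∀ k n → fall₂ (suc k) (suc k) * shift (rhsSeries (suc k)) n ≡ fall₂ (n ℕ.+ k) k * pronic (ι n)
rhs-shift-scaled k zero    = trans (ℚ.*-zeroʳ (fall₂ (suc k) (suc k))) (sym (ℚ.*-zeroʳ (fall₂ k k)))
rhs-shift-scaled k (suc n) = trans (rhs-scaled (suc k) n) (fall₂-diag n k)

rhs-shift²-scaled : ∀ k n → fall₂ (2 ℕ.+ k) (2 ℕ.+ k) * shift (shift (rhsSeries (2 ℕ.+ k))) n
                           ≡ fall₂ (n ℕ.+ k) k * pronic (ι n) * pronic (ι n - 1ℚ)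
rhs-shift²-scaled k zero    = begin
  fall₂ (2 ℕ.+ k) (2 ℕ.+ k) * 0ℚ          ≡⟨ ℚ.*-zeroʳ (fall₂ (2 ℕ.+ k) (2 ℕ.+ k)) ⟩
  0ℚ                                      ≡⟨ ℚ.*-zeroˡ (pronic (0ℚ - 1ℚ)) ⟨
  0ℚ * pronic (0ℚ - 1ℚ)                   ≡⟨ cong (_* pronic (0ℚ - 1ℚ)) (ℚ.*-zeroʳ (fall₂ k k)) ⟨
  fall₂ k k * 0ℚ * pronic (0ℚ - 1ℚ)       ∎
rhs-shift²-scaled k (suc n) = begin
  fall₂ (2 ℕ.+ k) (2 ℕ.+ k) * shift (rhsSeries (2 ℕ.+ k)) n  ≡⟨ rhs-shift-scaled (suc k) n ⟩
  fall₂ (n ℕ.+ suc k) (suc k) * pronic (ι n)                  ≡⟨ cong (_* pronic (ι n)) (fall₂-diag n k) ⟩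
  fall₂ (suc n ℕ.+ k) k * pronic (ι (suc n)) * pronic (ι n)   ≡⟨ cong (λ x → fall₂ (suc n ℕ.+ k) k * pronic (ι (suc n)) * pronic x) (pred-ι (ι n)) ⟩
  fall₂ (suc n ℕ.+ k) k * pronic (ι (suc n)) * pronic (ι (suc n) - 1ℚ) ∎
  where
  pred-ι : ∀ x → x ≡ (1ℚ + x) - 1ℚ
  pred-ι = solve-∀ ℚ-ring

-- The recurrence of rhsSeries multiplied by fall₂ (2 + t) (2 + t), with ν = ι n, τ = ι t and
-- X = fall₂ (n + t) t; pronic q = q (1 + q) is written out for the ring solver.
rhsSeries-recurrence-polynomial : ∀ v t X →
  (3ℚ + t) * (((1ℚ + (v + (1ℚ + t))) * (1ℚ + (1ℚ + (v + (1ℚ + t)))) * ((1ℚ + (v + t)) * (1ℚ + (1ℚ + (v + t))) * X)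
               - (1ℚ + (v + t)) * (1ℚ + (1ℚ + (v + t))) * X * (v * (1ℚ + v)))
             - ((1ℚ + (v + t)) * (1ℚ + (1ℚ + (v + t))) * X * (v * (1ℚ + v))
               - X * (v * (1ℚ + v)) * ((v - 1ℚ) * (1ℚ + (v - 1ℚ)))))
  ≡ (3ℚ + 2ℚ * t) * ((1ℚ + (1ℚ + t)) * (1ℚ + (1ℚ + (1ℚ + t))) * ((1ℚ + (v + t)) * (1ℚ + (1ℚ + (v + t))) * X)
                     + (1ℚ + (1ℚ + t)) * (1ℚ + (1ℚ + (1ℚ + t))) * (X * (v * (1ℚ + v))))
    - t * ((1ℚ + (1ℚ + t)) * (1ℚ + (1ℚ + (1ℚ + t))) * ((1ℚ + t) * (1ℚ + (1ℚ + t)) * X))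
rhsSeries-recurrence-polynomial = solve-∀ ℚ-ring

rhsSeries-recurrence : ∀ t → let τ = ι t in
  (3ℚ + τ) ·ₛ ∇ (∇ (rhsSeries (2 ℕ.+ t)))
    ≗ (3ℚ + 2ℚ * τ) ·ₛ ∇⁺ (rhsSeries (1 ℕ.+ t)) -ₛ τ ·ₛ rhsSeries t
rhsSeries-recurrence t n = *-cancelˡ-≢0 c (fall₂-diag≢0 (2 ℕ.+ t)) (begin
  c * ((3ℚ + τ) * ((A₂ n - shift A₂ n) - shift (∇ A₂) n))
    ≡⟨ cong (λ x → c * ((3ℚ + τ) * ((A₂ n - shift A₂ n) - x))) (shift-∇ A₂ n) ⟩
  c * ((3ℚ + τ) * ((A₂ n - shift A₂ n) - (shift A₂ n - shift (shift A₂) n)))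
    ≡⟨ distribˡ c (3ℚ + τ) (A₂ n) (shift A₂ n) (shift (shift A₂) n) ⟩
  (3ℚ + τ) * ((c * A₂ n - c * shift A₂ n) - (c * shift A₂ n - c * shift (shift A₂) n))
    ≡⟨ cong₃ (λ x y z → (3ℚ + τ) * ((x - y) - (y - z))) scaled-A₂ scaled-xA₂ scaled-x²A₂ ⟩
  (3ℚ + τ) * ((pronic (1ℚ + (ν + (1ℚ + τ))) * (pronic (1ℚ + (ν + τ)) * X)
                - pronic (1ℚ + (ν + τ)) * X * pronic ν)
             - (pronic (1ℚ + (ν + τ)) * X * pronic ν - X * pronic ν * pronic (ν - 1ℚ)))
    ≡⟨ rhsSeries-recurrence-polynomial ν τ X ⟩
  (3ℚ + 2ℚ * τ) * (pronic (1ℚ + (1ℚ + τ)) * (pronic (1ℚ + (ν + τ)) * X)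
                   + pronic (1ℚ + (1ℚ + τ)) * (X * pronic ν))
    - τ * (pronic (1ℚ + (1ℚ + τ)) * (pronic (1ℚ + τ) * X))
    ≡⟨ cong₃ (λ x y z → (3ℚ + 2ℚ * τ) * (x + y) - τ * z) scaled-A₁ scaled-xA₁ scaled-A₀ ⟨
  (3ℚ + 2ℚ * τ) * (c * A₁ n + c * shift A₁ n) - τ * (c * A₀ n)
    ≡⟨ distribʳ c (3ℚ + 2ℚ * τ) τ (A₁ n) (shift A₁ n) (A₀ n) ⟩
  c * ((3ℚ + 2ℚ * τ) * (A₁ n + shift A₁ n) - τ * A₀ n) ∎)
  where
  τ = ι t
  ν = ι n
  c = fall₂ (2 ℕ.+ t) (2 ℕ.+ t)
  X = fall₂ (n ℕ.+ t) t
  A₀ = rhsSeries t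
  A₁ = rhsSeries (1 ℕ.+ t)
  A₂ = rhsSeries (2 ℕ.+ t)

  scaled-A₂ : c * A₂ n ≡ pronic (1ℚ + (ν + (1ℚ + τ))) * (pronic (1ℚ + (ν + τ)) * X)
  scaled-A₂ = trans (rhs-scaled (2 ℕ.+ t) n)
    (trans (fall₂-up n (1 ℕ.+ t)) (cong (pronic (1ℚ + (ν + (1ℚ + τ))) *_) (fall₂-up n t)))
  scaled-xA₂ : c * shift A₂ n ≡ pronic (1ℚ + (ν + τ)) * X * pronic ν
  scaled-xA₂ = trans (rhs-shift-scaled (1 ℕ.+ t) n) (cong (_* pronic ν) (fall₂-up n t))
  scaled-x²A₂ : c * shift (shift A₂) n ≡ X * pronic ν * pronic (ν - 1ℚ)
  scaled-x²A₂ = rhs-shift²-scaled t n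
  scaled-A₁ : c * A₁ n ≡ pronic (1ℚ + (1ℚ + τ)) * (pronic (1ℚ + (ν + τ)) * X)
  scaled-A₁ = trans (fall₂-diag-suc-* (1 ℕ.+ t) (A₁ n))
    (cong (pronic (1ℚ + (1ℚ + τ)) *_) (trans (rhs-scaled (1 ℕ.+ t) n) (fall₂-up n t)))
  scaled-xA₁ : c * shift A₁ n ≡ pronic (1ℚ + (1ℚ + τ)) * (X * pronic ν)
  scaled-xA₁ = trans (fall₂-diag-suc-* (1 ℕ.+ t) (shift A₁ n))
    (cong (pronic (1ℚ + (1ℚ + τ)) *_) (rhs-shift-scaled t n))
  scaled-A₀ : c * A₀ n ≡ pronic (1ℚ + (1ℚ + τ)) * (pronic (1ℚ + τ) * X)
  scaled-A₀ = trans (fall₂-diag-suc-* (1 ℕ.+ t) (A₀ n))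
    (cong (pronic (1ℚ + (1ℚ + τ)) *_) (trans (fall₂-diag-suc-* t (A₀ n)) (cong (pronic (1ℚ + τ) *_) (rhs-scaled t n))))

  distribˡ : ∀ c s x y z → c * (s * ((x - y) - (y - z))) ≡ s * ((c * x - c * y) - (c * y - c * z))
  distribˡ = solve-∀ ℚ-ring
  distribʳ : ∀ c a b x y z → a * (c * x + c * y) - b * (c * z) ≡ c * (a * (x + y) - b * z)
  distribʳ = solve-∀ ℚ-ring

cleared : ℕ → FPS
cleared k = ∇^ (2 ℕ.* k ℕ.+ 1) (rhsSeries k)

cleared-recurrence : Recurrence cleared
cleared-recurrence t n = begin
  (3ℚ + τ) * cleared (2 ℕ.+ t) n
    ≡⟨ cong (λ d → (3ℚ + τ) * ∇^ d A₂ n) (exponent₂ t) ⟩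
  (3ℚ + τ) * ∇ (∇ (∇^ e A₂)) n
    ≡⟨ cong ((3ℚ + τ) *_) (trans (∇^-∇ e (∇ A₂) n) (∇-cong (∇^-∇ e A₂) n)) ⟨
  (3ℚ + τ) * ∇^ e (∇ (∇ A₂)) n
    ≡⟨ ∇^-·ₛ e (3ℚ + τ) (∇ (∇ A₂)) n ⟨
  ∇^ e ((3ℚ + τ) ·ₛ ∇ (∇ A₂)) n
    ≡⟨ ∇^-cong e (rhsSeries-recurrence t) n ⟩
  ∇^ e ((3ℚ + 2ℚ * τ) ·ₛ ∇⁺ A₁ -ₛ τ ·ₛ A₀) n
    ≡⟨ ∇^--ₛ e ((3ℚ + 2ℚ * τ) ·ₛ ∇⁺ A₁) (τ ·ₛ A₀) n ⟩
  ∇^ e ((3ℚ + 2ℚ * τ) ·ₛ ∇⁺ A₁) n - ∇^ e (τ ·ₛ A₀) n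
    ≡⟨ cong₂ _-_ (trans (∇^-·ₛ e (3ℚ + 2ℚ * τ) (∇⁺ A₁) n) (cong ((3ℚ + 2ℚ * τ) *_) (∇^-∇⁺ e A₁ n)))
                 (trans (∇^-·ₛ e τ A₀ n) (cong (λ d → τ * ∇^ d A₀ n) (exponent₀ t))) ⟩
  (3ℚ + 2ℚ * τ) * ∇⁺ (cleared (1 ℕ.+ t)) n - τ * ∇ (∇ (cleared t)) n ∎
  where
  τ = ι t
  e = 2 ℕ.* (1 ℕ.+ t) ℕ.+ 1
  A₀ = rhsSeries t
  A₁ = rhsSeries (1 ℕ.+ t)
  A₂ = rhsSeries (2 ℕ.+ t)
  exponent₂ : ∀ t → 2 ℕ.* (2 ℕ.+ t) ℕ.+ 1 ≡ 2 ℕ.+ (2 ℕ.* (1 ℕ.+ t) ℕ.+ 1)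
  exponent₂ = ℕ-solve-∀
  exponent₀ : ∀ t → 2 ℕ.* (1 ℕ.+ t) ℕ.+ 1 ≡ 2 ℕ.+ (2 ℕ.* t ℕ.+ 1)
  exponent₀ = ℕ-solve-∀

gbin₂-scaled : ∀ m n → fall₂ n n * gbin₂ m n ≡ fall₂ m n
gbin₂-scaled m n = trans (ℚ.*-comm (fall₂ n n) _) (gbin₂-normal m n)

gbin₂-vanishes : ∀ {m n} → m < n → gbin₂ m n ≡ 0ℚ
gbin₂-vanishes {m} {n} m<n = *-cancelˡ-≢0 (fall₂ n n) (fall₂-diag≢0 n)
  (trans (gbin₂-scaled m n) (trans (fall₂-vanishes m<n) (sym (ℚ.*-zeroʳ (fall₂ n n)))))

gbin₂-shift-scaled : ∀ m n → fall₂ n n * shift (gbin₂ m) n ≡ pronic (ι n) * fall₂ m (n ∸ 1)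
gbin₂-shift-scaled m zero    = trans (ℚ.*-zeroʳ 1ℚ) (sym (ℚ.*-zeroˡ 1ℚ))
gbin₂-shift-scaled m (suc n) = trans (fall₂-diag-suc-* n (gbin₂ m n)) (cong (pronic (ι (suc n)) *_) (gbin₂-scaled m n))

gbin₂-shift²-scaled : ∀ m n → fall₂ n n * shift (shift (gbin₂ m)) n
                             ≡ pronic (ι n) * (pronic (ι n - 1ℚ) * fall₂ m (n ∸ 2))
gbin₂-shift²-scaled m zero    = trans (ℚ.*-zeroʳ 1ℚ) (sym (ℚ.*-zeroˡ (pronic (0ℚ - 1ℚ) * 1ℚ)))
gbin₂-shift²-scaled m (suc n) = begin
  fall₂ (suc n) (suc n) * shift (gbin₂ m) n
    ≡⟨ fall₂-diag-suc-* n (shift (gbin₂ m) n) ⟩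
  pronic (ι (suc n)) * (fall₂ n n * shift (gbin₂ m) n)
    ≡⟨ cong (pronic (ι (suc n)) *_) (gbin₂-shift-scaled m n) ⟩
  pronic (ι (suc n)) * (pronic (ι n) * fall₂ m (n ∸ 1))
    ≡⟨ cong (λ x → pronic (ι (suc n)) * (pronic x * fall₂ m (n ∸ 1))) (pred-ι (ι n)) ⟩
  pronic (ι (suc n)) * (pronic (ι (suc n) - 1ℚ) * fall₂ m (n ∸ 1)) ∎
  where
  pred-ι : ∀ x → x ≡ (1ℚ + x) - 1ℚ
  pred-ι = solve-∀ ℚ-ring

fall₂-recurrence : ∀ s n → let σ = ι s ; ν = ι n in
  (3ℚ + (1ℚ + σ)) * fall₂ (2 ℕ.+ s) n
    ≡ (3ℚ + 2ℚ * (1ℚ + σ)) * (fall₂ (1 ℕ.+ s) n + pronic ν * fall₂ (1 ℕ.+ s) (n ∸ 1))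
      - (1ℚ + σ) * ((fall₂ s n - pronic ν * fall₂ s (n ∸ 1))
                    - (pronic ν * fall₂ s (n ∸ 1) - pronic ν * (pronic (ν - 1ℚ) * fall₂ s (n ∸ 2))))
fall₂-recurrence s zero = identity (ι s)
  where
  identity : ∀ σ → (3ℚ + (1ℚ + σ)) * 1ℚ
    ≡ (3ℚ + 2ℚ * (1ℚ + σ)) * (1ℚ + 0ℚ * 1ℚ)
      - (1ℚ + σ) * ((1ℚ - 0ℚ * 1ℚ) - (0ℚ * 1ℚ - 0ℚ * (0ℚ * 1ℚ)))
  identity = solve-∀ ℚ-ring
fall₂-recurrence s (suc zero) = identity (ι s)
  where
  identity : ∀ σ → (3ℚ + (1ℚ + σ)) * (1ℚ * ((1ℚ + (1ℚ + σ)) * (1ℚ + (1ℚ + (1ℚ + σ)))))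
    ≡ (3ℚ + 2ℚ * (1ℚ + σ)) * (1ℚ * ((1ℚ + σ) * (1ℚ + (1ℚ + σ))) + 2ℚ * 1ℚ)
      - (1ℚ + σ) * ((1ℚ * (σ * (1ℚ + σ)) - 2ℚ * 1ℚ) - (2ℚ * 1ℚ - 2ℚ * (0ℚ * 1ℚ)))
  identity = solve-∀ ℚ-ring
-- Every term is a polynomial in s and j times fall₂ s j.
fall₂-recurrence s (suc (suc j))
  rewrite fall₂-suc (suc s) (suc j) | fall₂-suc s (suc j) | fall₂-suc s j
        | fall₂-step s (suc j) | fall₂-step s j = identity (ι s) (ι j) (fall₂ s j)
  where
  identity : ∀ σ μ Y →
    (3ℚ + (1ℚ + σ)) * ((1ℚ + (1ℚ + σ)) * (1ℚ + (1ℚ + (1ℚ + σ))) * ((1ℚ + σ) * (1ℚ + (1ℚ + σ)) * Y))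
    ≡ (3ℚ + 2ℚ * (1ℚ + σ)) * ((1ℚ + σ) * (1ℚ + (1ℚ + σ)) * (Y * ((σ - μ) * (1ℚ + (σ - μ))))
                              + (1ℚ + (1ℚ + μ)) * (1ℚ + (1ℚ + (1ℚ + μ))) * ((1ℚ + σ) * (1ℚ + (1ℚ + σ)) * Y))
      - (1ℚ + σ) * ((Y * ((σ - μ) * (1ℚ + (σ - μ))) * ((σ - (1ℚ + μ)) * (1ℚ + (σ - (1ℚ + μ))))
                     - (1ℚ + (1ℚ + μ)) * (1ℚ + (1ℚ + (1ℚ + μ))) * (Y * ((σ - μ) * (1ℚ + (σ - μ)))))
                    - ((1ℚ + (1ℚ + μ)) * (1ℚ + (1ℚ + (1ℚ + μ))) * (Y * ((σ - μ) * (1ℚ + (σ - μ))))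
                       - (1ℚ + (1ℚ + μ)) * (1ℚ + (1ℚ + (1ℚ + μ)))
                         * ((1ℚ + (1ℚ + μ) - 1ℚ) * (1ℚ + (1ℚ + (1ℚ + μ) - 1ℚ)) * Y)))
  identity = solve-∀ ℚ-ring

gbin₂-recurrence : ∀ s → let τ = ι (1 ℕ.+ s) in
  (3ℚ + τ) ·ₛ gbin₂ (2 ℕ.+ s) ≗ (3ℚ + 2ℚ * τ) ·ₛ ∇⁺ (gbin₂ (1 ℕ.+ s)) -ₛ τ ·ₛ ∇ (∇ (gbin₂ s))
gbin₂-recurrence s n = *-cancelˡ-≢0 c (fall₂-diag≢0 n) (begin
  c * ((3ℚ + τ) * G₂ n)                  ≡⟨ x∙yz≈y∙xz c (3ℚ + τ) (G₂ n) ⟩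
  (3ℚ + τ) * (c * G₂ n)                  ≡⟨ cong ((3ℚ + τ) *_) (gbin₂-scaled (2 ℕ.+ s) n) ⟩
  (3ℚ + τ) * fall₂ (2 ℕ.+ s) n           ≡⟨ fall₂-recurrence s n ⟩
  (3ℚ + 2ℚ * τ) * (fall₂ (1 ℕ.+ s) n + pronic ν * fall₂ (1 ℕ.+ s) (n ∸ 1))
    - τ * ((fall₂ s n - pronic ν * fall₂ s (n ∸ 1))
           - (pronic ν * fall₂ s (n ∸ 1) - pronic ν * (pronic (ν - 1ℚ) * fall₂ s (n ∸ 2))))
    ≡⟨ cong₂ (λ u v → (3ℚ + 2ℚ * τ) * u - τ * v)
         (cong₂ _+_ (gbin₂-scaled (1 ℕ.+ s) n) (gbin₂-shift-scaled (1 ℕ.+ s) n))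
         (cong₃ (λ x y z → (x - y) - (y - z))
           (gbin₂-scaled s n) (gbin₂-shift-scaled s n) (gbin₂-shift²-scaled s n)) ⟨
  (3ℚ + 2ℚ * τ) * (c * G₁ n + c * shift G₁ n)
    - τ * ((c * G₀ n - c * shift G₀ n) - (c * shift G₀ n - c * shift (shift G₀) n))
    ≡⟨ distrib c (3ℚ + 2ℚ * τ) τ (G₁ n) (shift G₁ n) (G₀ n) (shift G₀ n) (shift (shift G₀) n) ⟩
  c * ((3ℚ + 2ℚ * τ) * (G₁ n + shift G₁ n) - τ * ((G₀ n - shift G₀ n) - (shift G₀ n - shift (shift G₀) n)))
    ≡⟨ cong (λ x → c * ((3ℚ + 2ℚ * τ) * (G₁ n + shift G₁ n) - τ * ((G₀ n - shift G₀ n) - x))) (shift-∇ G₀ n) ⟨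
  c * ((3ℚ + 2ℚ * τ) * (G₁ n + shift G₁ n) - τ * ((G₀ n - shift G₀ n) - shift (∇ G₀) n)) ∎)
  where
  τ = ι (1 ℕ.+ s)
  ν = ι n
  c = fall₂ n n
  G₀ = gbin₂ s
  G₁ = gbin₂ (1 ℕ.+ s)
  G₂ = gbin₂ (2 ℕ.+ s)
  distrib : ∀ c a b x₁ y₁ x₀ y₀ z₀ →
    a * (c * x₁ + c * y₁) - b * ((c * x₀ - c * y₀) - (c * y₀ - c * z₀))
      ≡ c * (a * (x₁ + y₁) - b * ((x₀ - y₀) - (y₀ - z₀)))
  distrib = solve-∀ ℚ-ring

numer-suc : ∀ s → numer (suc s) ≗ gbin₂ s
numer-suc s n with n ℕ.<? suc s
... | yes _   = refl
... | no  n≮ = sym (gbin₂-vanishes (ℕ.≰⇒> (n≮ ∘ s≤s)))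

numer-recurrence : Recurrence numer
numer-recurrence zero zero                = refl
numer-recurrence zero (suc zero)          = refl
numer-recurrence zero (suc (suc n))       = refl
numer-recurrence (suc s) n = begin
  (3ℚ + τ) * numer (3 ℕ.+ s) n
    ≡⟨ cong ((3ℚ + τ) *_) (numer-suc (2 ℕ.+ s) n) ⟩
  (3ℚ + τ) * gbin₂ (2 ℕ.+ s) n
    ≡⟨ gbin₂-recurrence s n ⟩
  (3ℚ + 2ℚ * τ) * ∇⁺ (gbin₂ (1 ℕ.+ s)) n - τ * ∇ (∇ (gbin₂ s)) n
    ≡⟨ cong₂ (λ u v → (3ℚ + 2ℚ * τ) * u - τ * v)
         (∇⁺-cong (numer-suc (1 ℕ.+ s)) n) (∇-cong (∇-cong (numer-suc s)) n) ⟨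
  (3ℚ + 2ℚ * τ) * ∇⁺ (numer (2 ℕ.+ s)) n - τ * ∇ (∇ (numer (1 ℕ.+ s))) n ∎
  where τ = ι (1 ℕ.+ s)

numer-1 : numer 1 ≗ oneS
numer-1 zero    = refl
numer-1 (suc n) = refl

cleared-1 : cleared 1 ≗ numer 1
cleared-1 n = *-cancelˡ-≢0 2ℚ (λ ()) (begin
  2ℚ * ∇ (∇ (∇ A₁)) n                      ≡⟨ ∇^-·ₛ 3 2ℚ A₁ n ⟨
  ∇ (∇ (∇ (2ℚ ·ₛ A₁))) n                   ≡⟨ ∇-cong (∇-cong (∇-cong doubled-A₁)) n ⟩
  ∇ (∇ (∇ (pronic ∘ ι ∘ suc))) n            ≡⟨ ∇-cong (∇-cong ∇-pronic) n ⟩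
  ∇ (∇ (2ℚ ·ₛ (ι ∘ suc))) n                ≡⟨ ∇^-·ₛ 2 2ℚ (ι ∘ suc) n ⟩
  2ℚ * ∇ (∇ (ι ∘ suc)) n                   ≡⟨ cong (2ℚ *_) (∇-cong ∇-ι n) ⟩
  2ℚ * ∇ (λ _ → 1ℚ) n                      ≡⟨ cong (2ℚ *_) (∇-1 n) ⟩
  2ℚ * oneS n                              ≡⟨ cong (2ℚ *_) (numer-1 n) ⟨
  2ℚ * numer 1 n                           ∎)
  where
  A₁ = rhsSeries 1
  doubled-A₁ : 2ℚ ·ₛ A₁ ≗ pronic ∘ ι ∘ suc
  doubled-A₁ n = trans (rhs-scaled 1 n) (trans (ℚ.*-identityˡ _) (cong (pronic ∘ ι) (ℕ.+-comm n 1)))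
  ∇-pronic : ∇ (pronic ∘ ι ∘ suc) ≗ 2ℚ ·ₛ (ι ∘ suc)
  ∇-pronic zero    = refl
  ∇-pronic (suc n) = difference (ι n)
    where difference : ∀ x → (1ℚ + (1ℚ + x)) * (1ℚ + (1ℚ + (1ℚ + x))) - (1ℚ + x) * (1ℚ + (1ℚ + x))
                               ≡ 2ℚ * (1ℚ + (1ℚ + x))
          difference = solve-∀ ℚ-ring
  ∇-ι : ∇ (ι ∘ suc) ≗ λ _ → 1ℚ
  ∇-ι zero    = refl
  ∇-ι (suc n) = difference (ι n)
    where difference : ∀ x → (1ℚ + (1ℚ + x)) - (1ℚ + x) ≡ 1ℚ
          difference = solve-∀ ℚ-ring
  ∇-1 : ∇ (λ _ → 1ℚ) ≗ oneS
  ∇-1 zero    = refl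
  ∇-1 (suc n) = refl

theorem5 : (k : ℕ) → 1 ≤ k → (n : ℕ) →
    ((oneMinusX ^S (2 ℕ.* k ℕ.+ 1)) ⊛ rhsSeries k) n ≡ numer k n
theorem5 (suc k) _ n = begin
  ((oneMinusX ^S (2 ℕ.* suc k ℕ.+ 1)) ⊛ rhsSeries (suc k)) n
    ≡⟨ ^S-⊛ (2 ℕ.* suc k ℕ.+ 1) (rhsSeries (suc k)) n ⟩
  cleared (suc k) n
    ≡⟨ recurrence-unique {cleared} {numer} cleared-recurrence numer-recurrence cleared-1 k n ⟩
  numer (suc k) n ∎
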